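{- Let $n\geq 10$ and let $C\subseteq\mathbb{F}^n$ be a locating-dominating code. Then: 1. $s(\mathbf{c})\leq \frac{n}{2}+1+\frac{1}{n-1}$ for every $\mathbf{c}\in C$; 2. if $\mathbf{c}\in C$ is not a special codeword, then $s(\mathbf{c})\leq \frac{n}{2}+1$; 3. if $n\geq 13$ and $\mathbf{c}\in C$ is not a special codeword, then $s(\mathbf{c})\leq \frac{n}{2}+1+\frac{1}{n^2-5n}-\frac{2}{3n}$.
   Context: $\mathbb{F}^n$ is the binary Hamming space: the set of binary words of length $n$ with the Hamming distance $d$ (number of differing coordinates); two words are adjacent if they are at distance $1$. For a word $\mathbf{u}$, $N(\mathbf{u})$ is the set of words at distance $1$ from $\mathbf{u}$ and $N[\mathbf{u}]=N(\mathbf{u})\cup\{\mathbf{u}\}$. A code is a nonempty subset $C\subseteq\mathbb{F}^n$; its elements are codewords. For a word $\mathbf{u}$, $I(\mathbf{u})=C\cap N[\mathbf{u}]$. The code $C$ is locating-dominating if $I(\mathbf{u})\neq\emptyset$ for all $\mathbf{u}\in\mathbb{F}^n$ and $I(\mathbf{u})\neq I(\mathbf{v})$ for all distinct non-codewords $\mathbf{u},\mathbf{v}$. The share of a codeword $\mathbf{c}\in C$ is $s(\mathbf{c})=\sum_{\mathbf{v}\in N[\mathbf{c}]}1/|I(\mathbf{v})|$. A father is a word $\mathbf{u}$ with $|I(\mathbf{u})|\geq 3$. A son is a word $\mathbf{x}$ with $|I(\mathbf{x})|=2$ such that $I(\mathbf{x})\subseteq I(\mathbf{u})$ for some father $\mathbf{u}$.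 An orphan is a non-codeword $\mathbf{x}$ with $|I(\mathbf{x})|=1$. A codeword $\mathbf{c}$ is special if $I(\mathbf{c})=\{\mathbf{c}\}$, $N(\mathbf{c})$ contains exactly one orphan, and $N(\mathbf{c})$ contains exactly $n-2$ sons. -}

module Defs where

open import Data.Bool using (Bool; true; false; not; if_then_else_)
open import Data.Nat as ℕ using (ℕ; zero; suc)
open import Data.Integer using (+_)
open import Data.Fin using (Fin)
open import Data.Fin.Subset using (Subset; ∣_∣) renaming (_∈_ to _∈ₛ_)
open import Data.Vec using (Vec; []; _∷_; updateAt; lookup)
import Data.List as List
open import Data.List using (List; map; foldr; length; filter)
open import Data.List.Base using (allFin)
open import Data.Rational using (ℚ; _/_; _+_; 0ℚ)
open import Data.Product using (Σ; _×_; ∃)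
open import Relation.Binary.PropositionalEquality using (_≡_; _≢_)
open import Relation.Nullary using (¬_)
open import Function.Bundles using (_⇔_)

Word : ℕ → Set
Word n = Vec Bool n

Code : ℕ → Set
Code n = Word n → Bool

Nonempty : ∀ {n} → Code n → Set
Nonempty {n} C = Σ (Word n) λ c → C c ≡ true

dist : ∀ {n} → Word n → Word n → ℕ
dist [] [] = 0
dist (x ∷ xs) (y ∷ ys) = (if x Data.Bool.xor y then 1 else 0) ℕ.+ dist xs ys
  where import Data.Bool

flipAt : ∀ {n} → Fin n → Word n → Word n
flipAt i u = updateAt u i not

-- N(u) and N[u] as (duplicate-free) lists
nbrs : ∀ {n} → Word n → List (Word n)
nbrs {n} u = map (λ i → flipAt i u) (allFin n)

closedNbrs : ∀ {n} → Word n → List (Word n)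
closedNbrs u = u List.∷ nbrs u

InI : ∀ {n} → Code n → Word n → Word n → Set
InI C u w = (C w ≡ true) × (dist u w ℕ.≤ 1)

countTrue : ∀ {A : Set} → (A → Bool) → List A → ℕ
countTrue p List.[] = 0
countTrue p (x List.∷ xs) = (if p x then 1 else 0) ℕ.+ countTrue p xs

cardI : ∀ {n} → Code n → Word n → ℕ
cardI C u = countTrue C (closedNbrs u)

LocDom : ∀ {n} → Code n → Set
LocDom {n} C =
  ((u : Word n) → ¬ (cardI C u ≡ 0)) ×
  ((u v : Word n) → C u ≡ false → C v ≡ false → u ≢ v →
     ¬ ((w : Word n) → InI C u w ⇔ InI C v w))

-- 1/k as a rational (with 1/0 := 0, never used for k = 0 below)
recip : ℕ → ℚ
recip zero = 0ℚ
recip (suc k) = + 1 / suc k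

sumℚ : List ℚ → ℚ
sumℚ = foldr _+_ 0ℚ

share : ∀ {n} → Code n → Word n → ℚ
share C c = sumℚ (map (λ v → recip (cardI C v)) (closedNbrs c))

Father : ∀ {n} → Code n → Word n → Set
Father C u = 3 ℕ.≤ cardI C u

Son : ∀ {n} → Code n → Word n → Set
Son {n} C x = (cardI C x ≡ 2) ×
  Σ (Word n) λ u → Father C u × ((w : Word n) → InI C x w → InI C u w)

Orphan : ∀ {n} → Code n → Word n → Set
Orphan C x = (C x ≡ false) × (cardI C x ≡ 1)

ExactlyInN : ∀ {n} → ℕ → (Word n → Set) → Word n → Set
ExactlyInN {n} k P c =
  Σ (Subset n) λ S → (∣ S ∣ ≡ k) × ((i : Fin n) → (i ∈ₛ S) ⇔ P (flipAt i c))

Special : ∀ {n} → Code n → Word n → Set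
Special {n} C c =
  (C c ≡ true) ×
  ((w : Word n) → InI C c w ⇔ (w ≡ c)) ×
  ExactlyInN 1 (Orphan C) c ×
  ExactlyInN (n ℕ.∸ 2) (Son C) c

module Submission where

-- Let c be a codeword with neighbours x i, t i = |I(x i)|, and k codewords among the x i, so that
-- s(c) = 1/(k+1) + Σᵢ 1/t i.  Bounding 1/t by ½, plus ½ for an orphan (t = 1) and minus fixed amounts
-- once t ≥ 3, 4, 6 or 9, turns s(c) into n/2 + 1/(k+1) plus a combination of counts of orphans and of
-- "fathers" (t ≥ 3).  Locating-domination allows at most one orphan and forbids two adjacent
-- non-codewords x i, x j with t = 2; hence every non-orphan x m is a father or lies next to one, and when
-- k = 0 double counting gives n ≤ (#orphans) + Σ_{fathers} t.  The only configuration in which these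
-- counts do not push s(c) down to n/2 + 1 (and to n/2 + 37/39 when n ≥ 13, below the third bound) is
-- k = 0 with one orphan and a single father: exactly a special codeword, whose father then has t ≥ n − 1.

open import Defs
open import Data.Bool using (Bool; true; false; not; _∧_; if_then_else_)
import Data.Bool.Properties as Bool
open import Data.Fin using (Fin; zero; suc)
import Data.Fin.Properties as Fin
open import Data.Fin.Subset using (∣_∣) renaming (_∈_ to _∈ₛ_)
open import Data.List using (List; []; _∷_; tabulate)
import Data.List as List
import Data.List.Properties as Listₚ
open import Data.Product using (∃; _×_; _,_; proj₁; proj₂)
open import Data.Sum using (_⊎_; inj₁; inj₂; [_,_]′)
open import Data.Vec using ([]; _∷_)
import Data.Vec as Vec
import Data.Vec.Properties as Vecₚ
open import Function using (_∘_; _⇔_; mk⇔)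
import Function.Properties.Equivalence as ⇔
open import Relation.Binary.PropositionalEquality
  using (_≡_; _≢_; refl; sym; trans; cong; cong₂; subst; module ≡-Reasoning)
open import Relation.Nullary using (¬_; ¬?; Dec; yes; no; does; contradiction)
open import Relation.Nullary.Decidable using (False; toWitnessFalse; dec-true)

module Counting where

  open import Data.Nat
  open import Data.Nat.Properties
  open import Algebra.Properties.CommutativeSemigroup +-commutativeSemigroup using (x∙yz≈y∙xz)
  open import Algebra.Properties.Semiring.Sum +-*-semiring
    using (sum-cong-≗; ∑-comm; *-distribˡ-sum; ∑-distrib-+) renaming (sum to ∑)
    public

  indicator : Bool → ℕ
  indicator b = if b then 1 else 0

  count : ∀ {n} → (Fin n → Bool) → ℕ
  count p = ∑ (λ i → indicator (p i))

  does⇒ : ∀ {a} {A : Set a} (a? : Dec A) → does a? ≡ true → A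
  does⇒ (yes a) _ = a

  ¬does⇒ : ∀ {a} {A : Set a} (a? : Dec A) → does a? ≡ false → ¬ A
  ¬does⇒ (no ¬a) _ = ¬a

  indicator-does-elim : ∀ {a p} {A : Set a} (P : ℕ → Set p) (a? : Dec A) → (A → P 1) → (¬ A → P 0) →
    P (indicator (does a?))
  indicator-does-elim P (yes a)  P1 _  = P1 a
  indicator-does-elim P (no  ¬a) _  P0 = P0 ¬a

  ≤-+-*-indicator : ∀ {s a} b → s ≤ a + b → s ≤ a + b * indicator (does (suc a ≤? s))
  ≤-+-*-indicator {s} {a} b s≤a+b = indicator-does-elim (λ m → s ≤ a + b * m) (suc a ≤? s)
    (λ _ → subst (λ m → s ≤ a + m) (sym (*-identityʳ b)) s≤a+b)
    (λ a≱s → ≤-trans (≤-pred (≰⇒> a≱s)) (m≤m+n a _))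

  nor-true : ∀ a b → not a ∧ not b ≡ true → a ≡ false × b ≡ false
  nor-true false false _ = refl , refl

  indicator+≤⇒false : ∀ b {a} → indicator b + a ≤ a → b ≡ false
  indicator+≤⇒false false _       = refl
  indicator+≤⇒false true  1+a≤a = contradiction 1+a≤a (<-irrefl refl)

  ≰-by-computation : ∀ {m n} → {False (m ≤? n)} → ¬ m ≤ n
  ≰-by-computation {m} {n} {f} = toWitnessFalse f

  ∑-mono-≤ : ∀ {n} {f g : Fin n → ℕ} → (∀ i → f i ≤ g i) → ∑ f ≤ ∑ g
  ∑-mono-≤ {zero}  f≤g = z≤n
  ∑-mono-≤ {suc n} f≤g = +-mono-≤ (f≤g zero) (∑-mono-≤ (f≤g ∘ suc))

  ≤-∑ : ∀ {n} (f : Fin n → ℕ) i → f i ≤ ∑ f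
  ≤-∑ f zero    = m≤m+n _ _
  ≤-∑ f (suc i) = ≤-trans (≤-∑ (f ∘ suc) i) (m≤n+m _ _)

  ∑-ones : ∀ {n} {f : Fin n → ℕ} → (∀ i → f i ≡ 1) → ∑ f ≡ n
  ∑-ones {zero}  _   = refl
  ∑-ones {suc n} f≡1 = cong₂ _+_ (f≡1 zero) (∑-ones (f≡1 ∘ suc))

  ∑-restricted-≤ : ∀ {n} (p q : Fin n → Bool) (f : Fin n → ℕ) a b →
    (∀ i → p i ≡ true → f i ≤ a + b * indicator (q i)) →
    ∑ (λ i → indicator (p i) * f i) ≤ a * count p + b * count q
  ∑-restricted-≤ p q f a b bound = begin
    ∑ (λ i → indicator (p i) * f i)
      ≤⟨ ∑-mono-≤ pointwise ⟩
    ∑ (λ i → a * indicator (p i) + b * indicator (q i))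
      ≡⟨ ∑-distrib-+ (λ i → a * indicator (p i)) (λ i → b * indicator (q i)) ⟩
    ∑ (λ i → a * indicator (p i)) + ∑ (λ i → b * indicator (q i))
      ≡⟨ sym (cong₂ _+_ (*-distribˡ-sum a (λ i → indicator (p i))) (*-distribˡ-sum b (λ i → indicator (q i)))) ⟩
    a * count p + b * count q ∎
    where
    open ≤-Reasoning
    pointwise : ∀ i → indicator (p i) * f i ≤ a * indicator (p i) + b * indicator (q i)
    pointwise i with p i in pᵢ
    ... | false = z≤n
    ... | true  = begin
      1 * f i                       ≡⟨ *-identityˡ (f i) ⟩
      f i                           ≤⟨ bound i pᵢ ⟩
      a + b * indicator (q i)       ≡⟨ cong (_+ b * indicator (q i)) (sym (*-identityʳ a)) ⟩
      a * 1 + b * indicator (q i)   ∎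

  count-complement : ∀ {n} (p : Fin n → Bool) → count p + count (not ∘ p) ≡ n
  count-complement p = trans (sym (∑-distrib-+ (λ i → indicator (p i)) (λ i → indicator (not (p i)))))
    (∑-ones (λ i → one (p i)))
    where
    one : ∀ b → indicator b + indicator (not b) ≡ 1
    one true  = refl
    one false = refl

  count-mono : ∀ {n} {p q : Fin n → Bool} → (∀ i → p i ≡ true → q i ≡ true) → count p ≤ count q
  count-mono {p = p} {q} p⇒q = ∑-mono-≤ pointwise
    where
    pointwise : ∀ i → indicator (p i) ≤ indicator (q i)
    pointwise i with p i in pᵢ
    ... | false = z≤n
    ... | true  rewrite p⇒q i pᵢ = ≤-refl

  count-≤-split : ∀ {n} (p q : Fin n → Bool) → count p ≤ count (λ i → p i ∧ not (q i)) + count q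
  count-≤-split p q = ≤-trans (∑-mono-≤ pointwise)
    (≤-reflexive (∑-distrib-+ (λ i → indicator (p i ∧ not (q i))) (λ i → indicator (q i))))
    where
    pointwise : ∀ i → indicator (p i) ≤ indicator (p i ∧ not (q i)) + indicator (q i)
    pointwise i with p i | q i
    ... | false | _     = z≤n
    ... | true  | false = ≤-refl
    ... | true  | true  = ≤-refl

  count-pos : ∀ {n} (p : Fin n → Bool) {a} → p a ≡ true → 1 ≤ count p
  count-pos p {a} pa = subst (λ b → indicator b ≤ count p) pa (≤-∑ (λ i → indicator (p i)) a)

  count-zero : ∀ {n} (p : Fin n → Bool) → count p ≡ 0 → ∀ a → p a ≡ false
  count-zero p c≡0 a with p a in pa
  ... | false = refl
  ... | true  = contradiction (≤-trans (count-pos p pa) (≤-reflexive c≡0)) λ ()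

  count-extract : ∀ {n} (p : Fin n → Bool) → 1 ≤ count p → ∃ λ a → p a ≡ true
  count-extract {suc n} p 1≤c with p zero in p₀
  ... | true  = zero , p₀
  ... | false = let a , pa = count-extract (p ∘ suc) 1≤c in suc a , pa

  except : ∀ {n} → (Fin n → Bool) → Fin n → Fin n → Bool
  except p a i = if does (i Fin.≟ a) then false else p i

  except-true : ∀ {n} (p : Fin n → Bool) {a b} → b ≢ a → p b ≡ true → except p a b ≡ true
  except-true p {a} {b} b≢a pb with b Fin.≟ a
  ... | yes b≡a = contradiction b≡a b≢a
  ... | no  _   = pb

  except-true⁻¹ : ∀ {n} (p : Fin n → Bool) {a b} → except p a b ≡ true → b ≢ a × p b ≡ true
  except-true⁻¹ p {a} {b} e with b Fin.≟ a
  ... | no b≢a = b≢a , e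

  count-except : ∀ {n} (p : Fin n → Bool) a → count p ≡ indicator (p a) + count (except p a)
  count-except p zero    = refl
  count-except p (suc a) = begin
    indicator (p zero) + count (p ∘ suc)
      ≡⟨ cong (indicator (p zero) +_) (count-except (p ∘ suc) a) ⟩
    indicator (p zero) + (indicator (p (suc a)) + count (except (p ∘ suc) a))
      ≡⟨ x∙yz≈y∙xz (indicator (p zero)) (indicator (p (suc a))) _ ⟩
    indicator (p (suc a)) + (indicator (p zero) + count (except (p ∘ suc) a)) ∎
    where open ≡-Reasoning

  count-except-true : ∀ {n} (p : Fin n → Bool) {a} → p a ≡ true → count p ≡ suc (count (except p a))
  count-except-true p {a} pa = trans (count-except p a) (cong (λ b → indicator b + count (except p a)) pa)

  count-pair : ∀ {n} (p : Fin n → Bool) {a b} → b ≢ a → p a ≡ true → p b ≡ true → 2 ≤ count p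
  count-pair p b≢a pa pb =
    subst (2 ≤_) (sym (count-except-true p pa)) (s≤s (count-pos (except p _) (except-true p b≢a pb)))

  count-triple : ∀ {n} (p : Fin n → Bool) {a b d} → b ≢ a → d ≢ a → d ≢ b →
    p a ≡ true → p b ≡ true → p d ≡ true → 3 ≤ count p
  count-triple p b≢a d≢a d≢b pa pb pd = subst (3 ≤_) (sym (count-except-true p pa))
    (s≤s (count-pair (except p _) d≢b (except-true p b≢a pb) (except-true p d≢a pd)))

  count-other : ∀ {n} (p : Fin n → Bool) {a} → p a ≡ true → 2 ≤ count p → ∃ λ b → b ≢ a × p b ≡ true
  count-other p pa 2≤c =
    let b , e = count-extract (except p _) (≤-pred (≤-trans 2≤c (≤-reflexive (count-except-true p pa))))
    in b , except-true⁻¹ p e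

  count≤1⇒unique : ∀ {n} (p : Fin n → Bool) → count p ≤ 1 → ∀ {a b} → p a ≡ true → p b ≡ true → a ≡ b
  count≤1⇒unique p c≤1 {a} {b} pa pb with a Fin.≟ b
  ... | yes a≡b = a≡b
  ... | no  a≢b = contradiction (≤-trans (count-pair p (a≢b ∘ sym) pa pb) c≤1) λ { (s≤s ()) }

  unique⇒count≤1 : ∀ {n} (p : Fin n → Bool) → (∀ {a b} → p a ≡ true → p b ≡ true → a ≡ b) → count p ≤ 1
  unique⇒count≤1 p unique with count p ≤? 1
  ... | yes c≤1 = c≤1
  ... | no  c≰1 =
    let a , pa = count-extract p (≤-trans (s≤s z≤n) (≰⇒> c≰1))
        b , b≢a , pb = count-other p pa (≰⇒> c≰1)
    in contradiction (unique pb pa) b≢a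

open Counting

module HammingSpace where

  open import Data.Nat using (ℕ; zero; suc; _+_; _≤_; s≤s)
  open import Data.Nat.Properties using (n≤0⇒n≡0)

  flipAt-involutive : ∀ {n} (i : Fin n) (u : Word n) → flipAt i (flipAt i u) ≡ u
  flipAt-involutive zero    (b ∷ u) = cong (_∷ u) (Bool.not-involutive b)
  flipAt-involutive (suc i) (b ∷ u) = cong (b ∷_) (flipAt-involutive i u)

  flipAt-comm : ∀ {n} (i j : Fin n) (u : Word n) → flipAt i (flipAt j u) ≡ flipAt j (flipAt i u)
  flipAt-comm zero    zero    (b ∷ u) = refl
  flipAt-comm zero    (suc j) (b ∷ u) = refl
  flipAt-comm (suc i) zero    (b ∷ u) = refl
  flipAt-comm (suc i) (suc j) (b ∷ u) = cong (b ∷_) (flipAt-comm i j u)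

  flipAt-injective : ∀ {n} {i j : Fin n} (u : Word n) → flipAt i u ≡ flipAt j u → i ≡ j
  flipAt-injective {i = zero}  {zero}  u       _ = refl
  flipAt-injective {i = zero}  {suc j} (b ∷ u) e = contradiction (sym (cong Vec.head e)) (Bool.not-¬ refl)
  flipAt-injective {i = suc i} {zero}  (b ∷ u) e = contradiction (cong Vec.head e) (Bool.not-¬ refl)
  flipAt-injective {i = suc i} {suc j} (b ∷ u) e = cong suc (flipAt-injective u (cong Vec.tail e))

  dist-refl : ∀ {n} (u : Word n) → dist u u ≡ 0
  dist-refl []          = refl
  dist-refl (false ∷ u) = dist-refl u
  dist-refl (true  ∷ u) = dist-refl u

  dist-flipAt : ∀ {n} (i : Fin n) (u : Word n) → dist u (flipAt i u) ≡ 1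
  dist-flipAt zero    (false ∷ u) = cong suc (dist-refl u)
  dist-flipAt zero    (true  ∷ u) = cong suc (dist-refl u)
  dist-flipAt (suc i) (false ∷ u) = dist-flipAt i u
  dist-flipAt (suc i) (true  ∷ u) = dist-flipAt i u

  dist≡0⇒≡ : ∀ {n} (u w : Word n) → dist u w ≡ 0 → w ≡ u
  dist≡0⇒≡ []          []          _ = refl
  dist≡0⇒≡ (false ∷ u) (false ∷ w) d = cong (false ∷_) (dist≡0⇒≡ u w d)
  dist≡0⇒≡ (true  ∷ u) (true  ∷ w) d = cong (true ∷_) (dist≡0⇒≡ u w d)

  InClosedNbhd : ∀ {n} → Word n → Word n → Set
  InClosedNbhd u w = w ≡ u ⊎ ∃ λ m → w ≡ flipAt m u

  ∷-InClosedNbhd : ∀ {n} b {u w : Word n} → InClosedNbhd u w → InClosedNbhd (b ∷ u) (b ∷ w)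
  ∷-InClosedNbhd b (inj₁ w≡u)       = inj₁ (cong (b ∷_) w≡u)
  ∷-InClosedNbhd b (inj₂ (m , w≡u)) = inj₂ (suc m , cong (b ∷_) w≡u)

  dist≤1⇒InClosedNbhd : ∀ {n} (u w : Word n) → dist u w ≤ 1 → InClosedNbhd u w
  dist≤1⇒InClosedNbhd []          []          _       = inj₁ refl
  dist≤1⇒InClosedNbhd (false ∷ u) (true  ∷ w) (s≤s d) =
    inj₂ (zero , cong (true ∷_) (dist≡0⇒≡ u w (n≤0⇒n≡0 d)))
  dist≤1⇒InClosedNbhd (true  ∷ u) (false ∷ w) (s≤s d) =
    inj₂ (zero , cong (false ∷_) (dist≡0⇒≡ u w (n≤0⇒n≡0 d)))
  dist≤1⇒InClosedNbhd (false ∷ u) (false ∷ w) d = ∷-InClosedNbhd false (dist≤1⇒InClosedNbhd u w d)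
  dist≤1⇒InClosedNbhd (true  ∷ u) (true  ∷ w) d = ∷-InClosedNbhd true  (dist≤1⇒InClosedNbhd u w d)

  countTrue-tabulate : ∀ {A : Set} {n} (p : A → Bool) (f : Fin n → A) →
    countTrue p (tabulate f) ≡ count (p ∘ f)
  countTrue-tabulate {n = zero}  p f = refl
  countTrue-tabulate {n = suc n} p f = cong (indicator (p (f zero)) +_) (countTrue-tabulate p (f ∘ suc))

  cardI-flipAt : ∀ {n} (C : Code n) (u : Word n) →
    cardI C u ≡ indicator (C u) + count (λ m → C (flipAt m u))
  cardI-flipAt C u = cong (indicator (C u) +_)
    (trans (cong (countTrue C) (Listₚ.map-tabulate (λ i → i) (λ i → flipAt i u)))
           (countTrue-tabulate C (λ m → flipAt m u)))

  locating : ∀ {n} {C : Code n} → LocDom C → ∀ {u v} → C u ≡ false → C v ≡ false →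
    (∀ w → InI C u w ⇔ InI C v w) → u ≡ v
  locating (_ , separates) {u} {v} cu cv same with Vecₚ.≡-dec Bool._≟_ u v
  ... | yes u≡v = u≡v
  ... | no  u≢v = contradiction same (separates u v cu cv u≢v)

  ∣tabulate∣ : ∀ {n} (p : Fin n → Bool) → ∣ Vec.tabulate p ∣ ≡ count p
  ∣tabulate∣ {zero}  p = refl
  ∣tabulate∣ {suc n} p with p zero
  ... | true  = cong suc (∣tabulate∣ (p ∘ suc))
  ... | false = ∣tabulate∣ (p ∘ suc)

  ∈-tabulate : ∀ {n} (p : Fin n → Bool) i → i ∈ₛ Vec.tabulate p ⇔ p i ≡ true
  ∈-tabulate p i = mk⇔ (λ i∈ → trans (sym (Vecₚ.lookup∘tabulate p i)) (Vecₚ.[]=⇒lookup i∈))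
                       (λ pᵢ → Vecₚ.lookup⇒[]= i _ (trans (Vecₚ.lookup∘tabulate p i) pᵢ))

  count⇒ExactlyInN : ∀ {n} {P : Word n → Set} {c : Word n} (p : Fin n → Bool) →
    (∀ i → p i ≡ true ⇔ P (flipAt i c)) → ExactlyInN (count p) P c
  count⇒ExactlyInN p p⇔P = Vec.tabulate p , ∣tabulate∣ p , λ i → ⇔.trans (∈-tabulate p i) (p⇔P i)

open HammingSpace

module Neighbourhood {n} (C : Code n) (c : Word n) (c∈C : C c ≡ true) (ld : LocDom C) where

  open import Data.Nat
  open import Data.Nat.Properties

  x : Fin n → Word n
  x i = flipAt i c

  y : Fin n → Fin n → Word n
  y i m = flipAt m (x i)

  t : Fin n → ℕ
  t i = cardI C (x i)

  k : ℕ
  k = count (λ i → C (x i))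

  y-diag : ∀ i → y i i ≡ c
  y-diag i = flipAt-involutive i c

  y-sym : ∀ i m → y i m ≡ y m i
  y-sym i m = flipAt-comm m i c

  y-diag∈C : ∀ i → C (y i i) ≡ true
  y-diag∈C i = trans (cong C (y-diag i)) c∈C

  t≡ : ∀ i → t i ≡ indicator (C (x i)) + count (λ m → C (y i m))
  t≡ i = cardI-flipAt C (x i)

  cardI-c : cardI C c ≡ suc k
  cardI-c = trans (cardI-flipAt C c) (cong (λ b → indicator b + k) c∈C)

  y∈I : ∀ {i m} → C (y i m) ≡ true → InI C (x i) (y i m)
  y∈I {i} {m} y∈C = y∈C , ≤-reflexive (dist-flipAt m (x i))

  c∈I : ∀ i → InI C (x i) c
  c∈I i = subst (InI C (x i)) (y-diag i) (y∈I (y-diag∈C i))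

  1≤t : ∀ i → indicator (C (x i)) + 1 ≤ t i
  1≤t i = ≤-trans (+-monoʳ-≤ (indicator (C (x i))) (count-pos (C ∘ y i) (y-diag∈C i)))
                  (≤-reflexive (sym (t≡ i)))

  2≤t : ∀ {i m} → m ≢ i → C (y i m) ≡ true → indicator (C (x i)) + 2 ≤ t i
  2≤t {i} m≢i y∈C = ≤-trans (+-monoʳ-≤ (indicator (C (x i))) (count-pair (C ∘ y i) m≢i (y-diag∈C i) y∈C))
                            (≤-reflexive (sym (t≡ i)))

  3≤t : ∀ {i m l} → m ≢ i → l ≢ i → l ≢ m → C (y i m) ≡ true → C (y i l) ≡ true → 3 ≤ t i
  3≤t {i} m≢i l≢i l≢m yₘ∈C yₗ∈C =
    ≤-trans (count-triple (C ∘ y i) m≢i l≢i l≢m (y-diag∈C i) yₘ∈C yₗ∈C)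
    (≤-trans (m≤n+m _ (indicator (C (x i)))) (≤-reflexive (sym (t≡ i))))

  I-nonCodeword : ∀ {i w} → C (x i) ≡ false → InI C (x i) w →
    w ≡ c ⊎ ∃ λ m → m ≢ i × w ≡ y i m × C (y i m) ≡ true
  I-nonCodeword {i} x∉C (w∈C , d) with dist≤1⇒InClosedNbhd (x i) _ d
  ... | inj₁ refl = contradiction (trans (sym w∈C) x∉C) λ ()
  ... | inj₂ (m , refl) with m Fin.≟ i
  ...   | yes refl = inj₁ (y-diag i)
  ...   | no  m≢i  = inj₂ (m , m≢i , refl , w∈C)

  I-orphan : ∀ {i} → C (x i) ≡ false → t i ≡ 1 → ∀ w → InI C (x i) w ⇔ w ≡ c
  I-orphan {i} x∉C tᵢ≡1 w = mk⇔ to λ { refl → c∈I i }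
    where
    to : InI C (x i) w → w ≡ c
    to w∈I with I-nonCodeword x∉C w∈I
    ... | inj₁ w≡c                 = w≡c
    ... | inj₂ (m , m≢i , _ , y∈C) =
      contradiction (≤-trans (m≤n+m 2 _) (≤-trans (2≤t m≢i y∈C) (≤-reflexive tᵢ≡1))) ≰-by-computation

  I-pair : ∀ {i j} → C (x i) ≡ false → t i ≡ 2 → j ≢ i → C (y i j) ≡ true →
    ∀ w → InI C (x i) w ⇔ (w ≡ c ⊎ w ≡ y i j)
  I-pair {i} {j} x∉C tᵢ≡2 j≢i yⱼ∈C w = mk⇔ to from
    where
    to : InI C (x i) w → w ≡ c ⊎ w ≡ y i j
    to w∈I with I-nonCodeword x∉C w∈I
    ... | inj₁ w≡c = inj₁ w≡c
    ... | inj₂ (m , m≢i , w≡y , yₘ∈C) with m Fin.≟ j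
    ...   | yes refl = inj₂ w≡y
    ...   | no  m≢j  =
      contradiction (≤-trans (3≤t j≢i m≢i m≢j yⱼ∈C yₘ∈C) (≤-reflexive tᵢ≡2)) ≰-by-computation
    from : w ≡ c ⊎ w ≡ y i j → InI C (x i) w
    from (inj₁ refl) = c∈I i
    from (inj₂ refl) = y∈I yⱼ∈C

  orphan-unique : ∀ {i j} → C (x i) ≡ false → C (x j) ≡ false → t i ≡ 1 → t j ≡ 1 → i ≡ j
  orphan-unique xᵢ∉C xⱼ∉C tᵢ≡1 tⱼ≡1 = flipAt-injective c
    (locating ld xᵢ∉C xⱼ∉C λ w → ⇔.trans (I-orphan xᵢ∉C tᵢ≡1 w) (⇔.sym (I-orphan xⱼ∉C tⱼ≡1 w)))

  pairs-nonadjacent : ∀ {i j} → j ≢ i → C (x i) ≡ false → C (x j) ≡ false → t i ≡ 2 → t j ≡ 2 →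
    C (y i j) ≢ true
  pairs-nonadjacent {i} {j} j≢i xᵢ∉C xⱼ∉C tᵢ≡2 tⱼ≡2 yᵢⱼ∈C =
    j≢i (sym (flipAt-injective c (locating ld xᵢ∉C xⱼ∉C same)))
    where
    yⱼᵢ∈C : C (y j i) ≡ true
    yⱼᵢ∈C = trans (cong C (y-sym j i)) yᵢⱼ∈C
    same : ∀ w → InI C (x i) w ⇔ InI C (x j) w
    same w = ⇔.trans (I-pair xᵢ∉C tᵢ≡2 j≢i yᵢⱼ∈C w)
      (⇔.sym (subst (λ z → InI C (x j) w ⇔ (w ≡ c ⊎ w ≡ z)) (y-sym j i)
                    (I-pair xⱼ∉C tⱼ≡2 (j≢i ∘ sym) yⱼᵢ∈C w)))

  partner : ∀ {i} → C (x i) ≡ false → t i ≡ 2 → ∃ λ l → l ≢ i × C (y i l) ≡ true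
  partner {i} x∉C tᵢ≡2 = count-other (C ∘ y i) (y-diag∈C i)
    (≤-reflexive (trans (sym tᵢ≡2) (trans (t≡ i) (cong (λ b → indicator b + count (λ m → C (y i m))) x∉C))))

  partner-father : ∀ {i l} → C (x i) ≡ false → t i ≡ 2 → l ≢ i → C (y i l) ≡ true → 3 ≤ t l
  partner-father {i} {l} xᵢ∉C tᵢ≡2 l≢i yᵢₗ∈C with 2≤t (l≢i ∘ sym) (trans (cong C (y-sym l i)) yᵢₗ∈C)
  ... | 2+b≤tₗ with m≤n⇒m<n∨m≡n (≤-trans (m≤n+m 2 _) 2+b≤tₗ)
  ...   | inj₁ 2<tₗ = 2<tₗ
  ...   | inj₂ 2≡tₗ = contradiction yᵢₗ∈C (pairs-nonadjacent l≢i xᵢ∉C xₗ∉C tᵢ≡2 (sym 2≡tₗ))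
    where
    xₗ∉C : C (x l) ≡ false
    xₗ∉C = indicator+≤⇒false (C (x l)) (subst (indicator (C (x l)) + 2 ≤_) (sym 2≡tₗ) 2+b≤tₗ)

  father-near : ∀ {i} → C (x i) ≡ false → t i ≢ 1 → ∃ λ l → 3 ≤ t l × C (y l i) ≡ true
  father-near {i} x∉C tᵢ≢1
    with m≤n⇒m<n∨m≡n (≤∧≢⇒< (subst (λ b → indicator b + 1 ≤ t i) x∉C (1≤t i)) (tᵢ≢1 ∘ sym))
  ... | inj₁ 3≤tᵢ = i , 3≤tᵢ , y-diag∈C i
  ... | inj₂ 2≡tᵢ = let l , l≢i , yᵢₗ∈C = partner x∉C (sym 2≡tᵢ)
                    in l , partner-father x∉C (sym 2≡tᵢ) l≢i yᵢₗ∈C , trans (cong C (y-sym l i)) yᵢₗ∈C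

  isOrphan : Fin n → Bool
  isOrphan i = does (t i ≟ 1)

  orphans : ℕ
  orphans = count isOrphan

  count≥ : ℕ → ℕ
  count≥ a = count (λ i → does (a ≤? t i))

  Σfathers : ℕ
  Σfathers = ∑ (λ j → indicator (does (3 ≤? t j)) * t j)

  x∉C : k ≡ 0 → ∀ i → C (x i) ≡ false
  x∉C = count-zero (λ i → C (x i))

  k≡0⇒k≤1 : k ≡ 0 → k ≤ 1
  k≡0⇒k≤1 k≡0 = m≤n⇒m≤1+n (≤-reflexive k≡0)

  orphan∉C : ∀ {i} → t i ≡ 1 → C (x i) ≡ false
  orphan∉C {i} tᵢ≡1 = indicator+≤⇒false (C (x i)) (subst (indicator (C (x i)) + 1 ≤_) tᵢ≡1 (1≤t i))

  orphans≤1 : orphans ≤ 1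
  orphans≤1 = unique⇒count≤1 isOrphan λ {a} {b} ea eb →
    let ta≡1 = does⇒ (t a ≟ 1) ea ; tb≡1 = does⇒ (t b ≟ 1) eb
    in orphan-unique (orphan∉C ta≡1) (orphan∉C tb≡1) ta≡1 tb≡1

  nonorphan-outside : 3 ≤ n → k ≤ 1 → ∃ λ i → C (x i) ≡ false × t i ≢ 1
  nonorphan-outside 3≤n k≤1 =
    let i , qᵢ = count-extract q 1≤count-q
        xᵢ∉C , tᵢ≢1 = nor-true (C (x i)) _ qᵢ
    in i , xᵢ∉C , ¬does⇒ (t i ≟ 1) tᵢ≢1
    where
    q : Fin n → Bool
    q i = not (C (x i)) ∧ not (isOrphan i)
    n≤ : n ≤ k + (count q + orphans)
    n≤ = begin
      n                                ≡⟨ sym (count-complement (λ i → C (x i))) ⟩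
      k + count (λ i → not (C (x i)))  ≤⟨ +-monoʳ-≤ k (count-≤-split (λ i → not (C (x i))) isOrphan) ⟩
      k + (count q + orphans)          ∎
      where open ≤-Reasoning
    1≤count-q : 1 ≤ count q
    1≤count-q with count q | n≤
    ... | suc _ | _   = s≤s z≤n
    ... | zero  | n≤′ = contradiction (≤-trans 3≤n (≤-trans n≤′ (+-mono-≤ k≤1 orphans≤1))) ≰-by-computation

  father-exists : 3 ≤ n → k ≤ 1 → 1 ≤ count≥ 3
  father-exists 3≤n k≤1 =
    let i , xᵢ∉C , tᵢ≢1 = nonorphan-outside 3≤n k≤1
        l , 3≤tₗ , _ = father-near xᵢ∉C tᵢ≢1
    in count-pos (λ j → does (3 ≤? t j)) (dec-true (3 ≤? t l) 3≤tₗ)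

  -- Every non-orphan x m lies next to a father x l (possibly l = m, via y m m = c), and the
  -- codeword y l m is counted in t l; summing over m gives the bound.
  n≤orphans+Σfathers : k ≡ 0 → n ≤ orphans + Σfathers
  n≤orphans+Σfathers k≡0 = begin
    n
      ≡⟨ sym (count-complement isOrphan) ⟩
    orphans + count (not ∘ isOrphan)
      ≤⟨ +-monoʳ-≤ orphans (∑-mono-≤ covered) ⟩
    orphans + ∑ (λ m → ∑ (λ j → F j * indicator (C (y j m))))
      ≡⟨ cong (orphans +_) (sym (∑-comm (λ j m → F j * indicator (C (y j m))))) ⟩
    orphans + ∑ (λ j → ∑ (λ m → F j * indicator (C (y j m))))
      ≡⟨ cong (orphans +_) (sum-cong-≗ (λ j → sym (*-distribˡ-sum (F j) (λ m → indicator (C (y j m)))))) ⟩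
    orphans + ∑ (λ j → F j * count (C ∘ y j))
      ≤⟨ +-monoʳ-≤ orphans (∑-mono-≤ (λ j → *-monoʳ-≤ (F j) (count≤t j))) ⟩
    orphans + Σfathers ∎
    where
    open ≤-Reasoning
    F : Fin n → ℕ
    F j = indicator (does (3 ≤? t j))
    count≤t : ∀ j → count (C ∘ y j) ≤ t j
    count≤t j = ≤-trans (m≤n+m _ (indicator (C (x j)))) (≤-reflexive (sym (t≡ j)))
    covered : ∀ m → indicator (not (isOrphan m)) ≤ ∑ (λ j → F j * indicator (C (y j m)))
    covered m = indicator-does-elim (_≤ ∑ (λ j → F j * indicator (C (y j m)))) (¬? (t m ≟ 1))
      (λ tₘ≢1 →
        let l , 3≤tₗ , yₗₘ∈C = father-near (x∉C k≡0 m) tₘ≢1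
        in ≤-trans (≤-reflexive (cong₂ (λ a b → indicator a * indicator b)
                                       (sym (dec-true (3 ≤? t l) 3≤tₗ)) (sym yₗₘ∈C)))
                   (≤-∑ (λ j → F j * indicator (C (y j m))) l))
      (λ _ → z≤n)

  Σfathers-≤ : ∀ a b (V : ℕ → Bool) → (∀ j → 3 ≤ t j → t j ≤ a + b * indicator (V (t j))) →
    Σfathers ≤ a * count≥ 3 + b * count (λ j → V (t j))
  Σfathers-≤ a b V bound = ∑-restricted-≤ (λ j → does (3 ≤? t j)) (λ j → V (t j)) t a b
    (λ j e → bound j (does⇒ (3 ≤? t j) e))

  count≥-zero : ∀ a → count≥ (suc a) ≡ 0 → ∀ j → t j ≤ a
  count≥-zero a c≡0 j = ≤-pred (≰⇒> (¬does⇒ (suc a ≤? t j) (count-zero (λ i → does (suc a ≤? t i)) c≡0 j)))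

  count≥-antimono : ∀ {a b} → a ≤ b → count≥ b ≤ count≥ a
  count≥-antimono a≤b = count-mono λ i e → dec-true (_ ≤? t i) (≤-trans a≤b (does⇒ (_ ≤? t i) e))

  unique-father : count≥ 3 ≡ 1 → ∀ {i j} → 3 ≤ t i → 3 ≤ t j → i ≡ j
  unique-father u≡1 3≤tᵢ 3≤tⱼ = count≤1⇒unique (λ j → does (3 ≤? t j)) (≤-reflexive u≡1)
    (dec-true (3 ≤? t _) 3≤tᵢ) (dec-true (3 ≤? t _) 3≤tⱼ)

  pairs : ℕ
  pairs = count (λ i → does (t i ≟ 2))

  orphans+pairs+fathers : orphans + (pairs + count≥ 3) ≡ n
  orphans+pairs+fathers = begin
    orphans + (pairs + count≥ 3)
      ≡⟨ cong (orphans +_) (sym (∑-distrib-+ (λ i → [ t i ≟ 2 ]) (λ i → [ 3 ≤? t i ]))) ⟩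
    orphans + ∑ (λ i → [ t i ≟ 2 ] + [ 3 ≤? t i ])
      ≡⟨ sym (∑-distrib-+ (λ i → [ t i ≟ 1 ]) (λ i → [ t i ≟ 2 ] + [ 3 ≤? t i ])) ⟩
    ∑ (λ i → [ t i ≟ 1 ] + ([ t i ≟ 2 ] + [ 3 ≤? t i ]))
      ≡⟨ ∑-ones (λ i → exactly-one (t i) (≤-trans (m≤n+m 1 _) (1≤t i))) ⟩
    n ∎
    where
    open ≡-Reasoning
    [_] : ∀ {A : Set} → Dec A → ℕ
    [ a? ] = indicator (does a?)
    exactly-one : ∀ s → 1 ≤ s → [ s ≟ 1 ] + ([ s ≟ 2 ] + [ 3 ≤? s ]) ≡ 1
    exactly-one 1                   _ = refl
    exactly-one 2                   _ = refl
    exactly-one (suc (suc (suc _))) _ = refl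

  I-c-isolated : k ≡ 0 → ∀ w → InI C c w ⇔ w ≡ c
  I-c-isolated k≡0 w = mk⇔ to λ { refl → c∈C , subst (_≤ 1) (sym (dist-refl c)) z≤n }
    where
    to : InI C c w → w ≡ c
    to (w∈C , d) with dist≤1⇒InClosedNbhd c w d
    ... | inj₁ w≡c        = w≡c
    ... | inj₂ (m , refl) = contradiction (trans (sym w∈C) (x∉C k≡0 m)) λ ()

  orphans-ExactlyInN : ExactlyInN orphans (Orphan C) c
  orphans-ExactlyInN = count⇒ExactlyInN {P = Orphan C} {c} isOrphan λ i →
    mk⇔ (λ e → let tᵢ≡1 = does⇒ (t i ≟ 1) e in orphan∉C tᵢ≡1 , tᵢ≡1)
        (λ (_ , tᵢ≡1) → dec-true (t i ≟ 1) tᵢ≡1)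

  father-covers-pair : count≥ 3 ≡ 1 → ∀ {i j} → 3 ≤ t j → C (x i) ≡ false → t i ≡ 2 →
    ∀ w → InI C (x i) w → InI C (x j) w
  father-covers-pair u≡1 {i} 3≤tⱼ xᵢ∉C tᵢ≡2 w w∈I with I-nonCodeword xᵢ∉C w∈I
  ... | inj₁ refl = c∈I _
  ... | inj₂ (m , m≢i , refl , yᵢₘ∈C) with unique-father u≡1 (partner-father xᵢ∉C tᵢ≡2 m≢i yᵢₘ∈C) 3≤tⱼ
  ...   | refl = subst (InI C (x m)) (y-sym m i) (y∈I (trans (cong C (y-sym m i)) yᵢₘ∈C))

  pairs-ExactlyInN : k ≡ 0 → count≥ 3 ≡ 1 → ExactlyInN pairs (Son C) c
  pairs-ExactlyInN k≡0 u≡1 = count⇒ExactlyInN {P = Son C} {c} (λ i → does (t i ≟ 2)) λ i →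
    mk⇔ (λ e → let tᵢ≡2 = does⇒ (t i ≟ 2) e
               in tᵢ≡2 , x j , 3≤tⱼ , father-covers-pair u≡1 3≤tⱼ (x∉C k≡0 i) tᵢ≡2)
        (λ (tᵢ≡2 , _) → dec-true (t i ≟ 2) tᵢ≡2)
    where
    j : Fin n
    j = proj₁ (count-extract (λ j → does (3 ≤? t j)) (≤-reflexive (sym u≡1)))
    3≤tⱼ : 3 ≤ t j
    3≤tⱼ = does⇒ (3 ≤? t j) (proj₂ (count-extract (λ j → does (3 ≤? t j)) (≤-reflexive (sym u≡1))))

  special : k ≡ 0 → orphans ≡ 1 → count≥ 3 ≡ 1 → Special C c
  special k≡0 o≡1 u≡1 =
    c∈C , I-c-isolated k≡0 ,
    subst (λ m → ExactlyInN m (Orphan C) c) o≡1 orphans-ExactlyInN ,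
    subst (λ m → ExactlyInN m (Son C) c) pairs≡n∸2 (pairs-ExactlyInN k≡0 u≡1)
    where
    pairs≡n∸2 : pairs ≡ n ∸ 2
    pairs≡n∸2 = sym (trans (cong (_∸ 2) (sym orphans+pairs+fathers))
      (trans (cong₂ (λ a b → (a + (pairs + b)) ∸ 2) o≡1 u≡1) (m+n∸n≡m pairs 1)))

  module Isolated (k≡0 : k ≡ 0) (o≡1 : orphans ≡ 1) where

    n≤1+ : ∀ a b (V : ℕ → Bool) → (∀ j → 3 ≤ t j → t j ≤ a + b * indicator (V (t j))) →
      n ≤ 1 + (a * count≥ 3 + b * count (λ j → V (t j)))
    n≤1+ a b V bound = ≤-trans (n≤orphans+Σfathers k≡0)
      (+-mono-≤ (≤-reflexive o≡1) (Σfathers-≤ a b V bound))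

    n≤1+uniform : ∀ a → (∀ j → t j ≤ a) → n ≤ 1 + (a * count≥ 3 + 0)
    n≤1+uniform a t≤a = n≤1+ a 0 (λ _ → false) (λ j _ → ≤-trans (t≤a j) (m≤m+n a 0))

    large-father : count≥ 3 ≡ 1 → ∀ {i} → 3 ≤ t i → n ∸ 1 ≤ t i
    large-father u≡1 {i} 3≤tᵢ = m≤n+o⇒m∸n≤o n 1 (begin
      n                                                 ≤⟨ n≤1+ (t i) 0 (λ _ → false) tⱼ≤tᵢ ⟩
      1 + (t i * count≥ 3 + 0)                          ≡⟨ cong (λ u → 1 + (t i * u + 0)) u≡1 ⟩
      1 + (t i * 1 + 0)                                 ≡⟨ cong suc (trans (+-identityʳ _) (*-identityʳ _)) ⟩
      1 + t i                                           ∎)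
      where
      open ≤-Reasoning
      tⱼ≤tᵢ : ∀ j → 3 ≤ t j → t j ≤ t i + 0
      tⱼ≤tᵢ j 3≤tⱼ = ≤-reflexive (trans (cong t (unique-father u≡1 3≤tⱼ 3≤tᵢ)) (sym (+-identityʳ (t i))))

    three-fathers : count≥ 3 ≡ 3 → 13 ≤ n → 1 ≤ count≥ 4
    three-fathers u≡3 13≤n with count≥ 4 in c₄≡0
    ... | suc _ = s≤s z≤n
    ... | zero  = contradiction
      (≤-trans 13≤n (subst (λ u → n ≤ 1 + (3 * u + 0)) u≡3 (n≤1+uniform 3 (count≥-zero 3 c₄≡0))))
      ≰-by-computation

    two-fathers : count≥ 3 ≡ 2 → 10 ≤ n → 2 ≤ count≥ 4 + count≥ 6
    two-fathers u≡2 10≤n with count≥ 6 in c₆≡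
    ... | suc _ =
      +-mono-≤ (≤-trans (≤-trans (s≤s z≤n) (≤-reflexive (sym c₆≡))) (count≥-antimono 4≤6)) (s≤s z≤n)
      where
      4≤6 : 4 ≤ 6
      4≤6 = s≤s (s≤s (s≤s (s≤s z≤n)))
    ... | zero  = 2≤ (count≥ 4) (≤-trans 10≤n (subst (λ u → n ≤ 1 + (3 * u + 2 * count≥ 4)) u≡2
                    (n≤1+ 3 2 (λ s → does (4 ≤? s)) (λ j _ → ≤-+-*-indicator {a = 3} 2 (count≥-zero 5 c₆≡ j)))))
      where
      2≤ : ∀ c → 10 ≤ 1 + (3 * 2 + 2 * c) → 2 ≤ c + 0
      2≤ 0                 h = contradiction h ≰-by-computation
      2≤ 1                 h = contradiction h ≰-by-computation
      2≤ (suc (suc c)) _ = s≤s (s≤s z≤n)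

    two-fathers-13 : count≥ 3 ≡ 2 → 13 ≤ n → 3 ≤ count≥ 4 + count≥ 6 ⊎ 1 ≤ count≥ 9
    two-fathers-13 u≡2 13≤n with count≥ 4 ≤? 1
    ... | no  c₄≰1 = inj₁ (+-mono-≤ (≰⇒> c₄≰1) some-six)
      where
      some-six : 1 ≤ count≥ 6
      some-six with count≥ 6 in c₆≡0
      ... | suc _ = s≤s z≤n
      ... | zero  = contradiction
        (≤-trans 13≤n (subst (λ u → n ≤ 1 + (5 * u + 0)) u≡2 (n≤1+uniform 5 (count≥-zero 5 c₆≡0))))
        ≰-by-computation
    ... | yes c₄≤1 with count≥ 9 in c₉≡0
    ...   | suc _ = inj₂ (s≤s z≤n)
    ...   | zero  = contradiction (≤-trans 13≤n (≤-trans n≤ (+-monoʳ-≤ 1 (+-monoʳ-≤ 6 (*-monoʳ-≤ 5 c₄≤1)))))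
                      ≰-by-computation
      where
      n≤ : n ≤ 1 + (3 * 2 + 5 * count≥ 4)
      n≤ = subst (λ u → n ≤ 1 + (3 * u + 5 * count≥ 4)) u≡2
             (n≤1+ 3 5 (λ s → does (4 ≤? s)) (λ j _ → ≤-+-*-indicator {a = 3} 5 (count≥-zero 8 c₉≡0 j)))

module Rationals where

  open import Data.Nat as ℕ using (ℕ; zero; suc; z≤n; s≤s)
  import Data.Nat.Properties as ℕₚ
  open import Data.Integer as ℤ using (+_)
  import Data.Integer.Properties as ℤ
  open import Data.Integer.Tactic.RingSolver using (solve-∀)
  open import Data.Rational
  open import Data.Rational.Properties
  open import Data.Rational.Unnormalised as ℚᵘ using (mkℚᵘ; *≡*; *≤*)
  import Data.Rational.Unnormalised.Properties as ℚᵘ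
  open import Relation.Nullary.Decidable using (True; toWitness)
  open import Data.Rational.Solver using (module +-*-Solver)
  open import Algebra.Properties.CommutativeMonoid.Sum +-0-commutativeMonoid
    using ()
    renaming (sum to ∑ℚ; ∑-distrib-+ to ∑ℚ-distrib-+; sum-replicate to ∑ℚ-replicate;
              sum-replicate-zero to ∑ℚ-replicate-zero)
    public
  open import Algebra.Definitions.RawMonoid +-0-rawMonoid using () renaming (_×_ to _·_) public
  open import Algebra.Properties.Monoid.Mult +-0-monoid using (×-homo-+)

  ≤-by-computation : ∀ {p q} → {True (p ≤? q)} → p ≤ q
  ≤-by-computation {p} {q} {w} = toWitness w

  recip-nonneg : ∀ a → 0ℚ ≤ recip a
  recip-nonneg zero    = ≤-refl
  recip-nonneg (suc a) = nonNegative⁻¹ (+ 1 / suc a) {{normalize-nonNeg 1 (suc a)}}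

  recip-antimono : ∀ {a b} → 1 ℕ.≤ b → b ℕ.≤ a → recip a ≤ recip b
  recip-antimono {suc a} {suc b} _ b≤a = toℚᵘ-cancel-≤ (begin
    toℚᵘ (recip (suc a)) ≃⟨ toℚᵘ-fromℚᵘ (mkℚᵘ (+ 1) a) ⟩
    mkℚᵘ (+ 1) a         ≤⟨ *≤* (ℤ.*-monoˡ-≤-nonNeg (+ 1) (ℤ.+≤+ b≤a)) ⟩
    mkℚᵘ (+ 1) b         ≃⟨ ℚᵘ.≃-sym (toℚᵘ-fromℚᵘ (mkℚᵘ (+ 1) b)) ⟩
    toℚᵘ (recip (suc b)) ∎)
    where open ℚᵘ.≤-Reasoning

  ½+/2 : ∀ m → ½ + + m / 2 ≡ + suc m / 2
  ½+/2 m = toℚᵘ-injective (begin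
    toℚᵘ (½ + + m / 2)                ≈⟨ toℚᵘ-homo-+ ½ (+ m / 2) ⟩
    toℚᵘ ½ ℚᵘ.+ toℚᵘ (+ m / 2)
      ≈⟨ ℚᵘ.+-cong (toℚᵘ-fromℚᵘ (mkℚᵘ (+ 1) 1)) (toℚᵘ-fromℚᵘ (mkℚᵘ (+ m) 1)) ⟩
    mkℚᵘ (+ 1) 1 ℚᵘ.+ mkℚᵘ (+ m) 1    ≈⟨ *≡* (cross (+ m)) ⟩
    mkℚᵘ (+ suc m) 1                  ≈⟨ ℚᵘ.≃-sym (toℚᵘ-fromℚᵘ (mkℚᵘ (+ suc m) 1)) ⟩
    toℚᵘ (+ suc m / 2)                ∎)
    where
    open ℚᵘ.≃-Reasoning
    cross : ∀ z → (+ 1 ℤ.* + 2 ℤ.+ z ℤ.* + 2) ℤ.* + 2 ≡ (+ 1 ℤ.+ z) ℤ.* + 4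
    cross = solve-∀

  ·½ : ∀ m → m · ½ ≡ + m / 2
  ·½ zero    = refl
  ·½ (suc m) = trans (cong (λ q → ½ + q) (·½ m)) (½+/2 m)

  ·-monoˡ-≤ : ∀ v → 0ℚ ≤ v → ∀ {m m′} → m ℕ.≤ m′ → m · v ≤ m′ · v
  ·-monoˡ-≤ v 0≤v {zero}  {zero}   _          = ≤-refl
  ·-monoˡ-≤ v 0≤v {zero}  {suc m′} _          = ≤-trans (·-monoˡ-≤ v 0≤v {zero} {m′} z≤n)
    (≤-trans (≤-reflexive (sym (+-identityˡ (m′ · v)))) (+-monoˡ-≤ (m′ · v) 0≤v))
  ·-monoˡ-≤ v 0≤v {suc m} {suc m′} (s≤s m≤m′) = +-monoʳ-≤ v (·-monoˡ-≤ v 0≤v m≤m′)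

  ·-antimonoˡ-≤ : ∀ v → v ≤ 0ℚ → ∀ {m} m′ → m ℕ.≤ m′ → m′ · v ≤ m · v
  ·-antimonoˡ-≤ v v≤0 {zero}  zero     _          = ≤-refl
  ·-antimonoˡ-≤ v v≤0 {zero}  (suc m′) _          = ≤-trans (+-monoˡ-≤ (m′ · v) v≤0)
    (≤-trans (≤-reflexive (+-identityˡ (m′ · v))) (·-antimonoˡ-≤ v v≤0 m′ z≤n))
  ·-antimonoˡ-≤ v v≤0 {suc m} (suc m′) (s≤s m≤m′) = +-monoʳ-≤ v (·-antimonoˡ-≤ v v≤0 m′ m≤m′)

  ·-+-antimono : ∀ v → v ≤ 0ℚ → ∀ {a} b d r → a ℕ.≤ b ℕ.+ d → b · v + (d · v + r) ≤ a · v + r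
  ·-+-antimono v v≤0 {a} b d r a≤b+d = begin
    b · v + (d · v + r)   ≡⟨ sym (+-assoc (b · v) (d · v) r) ⟩
    (b · v + d · v) + r   ≡⟨ cong (_+ r) (sym (×-homo-+ v b d)) ⟩
    (b ℕ.+ d) · v + r     ≤⟨ +-monoˡ-≤ r (·-antimonoˡ-≤ v v≤0 (b ℕ.+ d) a≤b+d) ⟩
    a · v + r             ∎
    where open ≤-Reasoning

  ∑ℚ-mono-≤ : ∀ {n} {f g : Fin n → ℚ} → (∀ i → f i ≤ g i) → ∑ℚ f ≤ ∑ℚ g
  ∑ℚ-mono-≤ {zero}  f≤g = ≤-refl
  ∑ℚ-mono-≤ {suc n} f≤g = +-mono-≤ (f≤g zero) (∑ℚ-mono-≤ (f≤g ∘ suc))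

  ∑ℚ-if : ∀ {n} (p : Fin n → Bool) v → ∑ℚ (λ i → if p i then v else 0ℚ) ≡ count p · v
  ∑ℚ-if {zero}  p v = refl
  ∑ℚ-if {suc n} p v with p zero
  ... | true  = cong (λ q → v + q) (∑ℚ-if (p ∘ suc) v)
  ... | false = trans (+-identityˡ _) (∑ℚ-if (p ∘ suc) v)

  sumℚ-tabulate : ∀ {A : Set} {n} (f : A → ℚ) (g : Fin n → A) →
    sumℚ (List.map f (tabulate g)) ≡ ∑ℚ (f ∘ g)
  sumℚ-tabulate {n = zero}  f g = refl
  sumℚ-tabulate {n = suc n} f g = cong (λ q → f (g zero) + q) (sumℚ-tabulate f (g ∘ suc))

  -- A bonus (P , v) adds v to the bound on 1/s whenever P s holds.
  Bonus : Set
  Bonus = List ((ℕ → Bool) × ℚ)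

  bonus : Bonus → ℕ → ℚ
  bonus []            s = 0ℚ
  bonus ((P , v) ∷ B) s = (if P s then v else 0ℚ) + bonus B s

  total : ∀ {n} → Bonus → (Fin n → ℕ) → ℚ
  total []            t = 0ℚ
  total ((P , v) ∷ B) t = count (λ i → P (t i)) · v + total B t

  ∑-bonus : ∀ {n} (B : Bonus) (t : Fin n → ℕ) → ∑ℚ (λ i → bonus B (t i)) ≡ total B t
  ∑-bonus {n} []        t = ∑ℚ-replicate-zero n
  ∑-bonus ((P , v) ∷ B) t = trans (∑ℚ-distrib-+ (λ i → if P (t i) then v else 0ℚ) (λ i → bonus B (t i)))
    (cong₂ _+_ (∑ℚ-if (λ i → P (t i)) v) (∑-bonus B t))

  orphan-bonus : (ℕ → Bool) × ℚ
  orphan-bonus = (λ s → does (s ℕ.≟ 1)) , ½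

  Dominates : Bonus → Set
  Dominates B = ∀ s → recip s ≤ ½ + bonus (orphan-bonus ∷ B) s

  at-least : ℕ → ℚ → (ℕ → Bool) × ℚ
  at-least a v = (λ s → does (a ℕ.≤? s)) , v

  coarse : Bonus
  coarse = at-least 3 (- (+ 1 / 6)) ∷ []

  fine₄₆ : Bonus
  fine₄₆ = at-least 3 (- (+ 1 / 6)) ∷ at-least 4 (- (+ 1 / 12)) ∷ at-least 6 (- (+ 1 / 12)) ∷ []

  fine₉ : Bonus
  fine₉ = at-least 3 (- (+ 1 / 6)) ∷ at-least 9 (- (+ 2 / 9)) ∷ []

  star : ℚ → Bonus
  star r = at-least 3 (r - ½) ∷ []

  recip-+-≤ : ∀ a m → recip (suc a ℕ.+ m) ≤ recip (suc a)
  recip-+-≤ a m = recip-antimono (s≤s z≤n) (ℕₚ.m≤m+n (suc a) m)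

  coarse-dominates : Dominates coarse
  coarse-dominates 0                   = ≤-by-computation
  coarse-dominates 1                   = ≤-by-computation
  coarse-dominates 2                   = ≤-by-computation
  coarse-dominates (suc (suc (suc m))) = ≤-trans (recip-+-≤ 2 m) ≤-by-computation

  fine₄₆-dominates : Dominates fine₄₆
  fine₄₆-dominates 0 = ≤-by-computation
  fine₄₆-dominates 1 = ≤-by-computation
  fine₄₆-dominates 2 = ≤-by-computation
  fine₄₆-dominates 3 = ≤-by-computation
  fine₄₆-dominates 4 = ≤-by-computation
  fine₄₆-dominates 5 = ≤-by-computation
  fine₄₆-dominates (suc (suc (suc (suc (suc (suc m)))))) = ≤-trans (recip-+-≤ 5 m) ≤-by-computation

  fine₉-dominates : Dominates fine₉
  fine₉-dominates 0 = ≤-by-computation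
  fine₉-dominates 1 = ≤-by-computation
  fine₉-dominates 2 = ≤-by-computation
  fine₉-dominates 3 = ≤-by-computation
  fine₉-dominates 4 = ≤-by-computation
  fine₉-dominates 5 = ≤-by-computation
  fine₉-dominates 6 = ≤-by-computation
  fine₉-dominates 7 = ≤-by-computation
  fine₉-dominates 8 = ≤-by-computation
  fine₉-dominates (suc (suc (suc (suc (suc (suc (suc (suc (suc m))))))))) =
    ≤-trans (recip-+-≤ 8 m) ≤-by-computation

  star-dominates : ∀ N → 1 ℕ.≤ N → ∀ s → (3 ℕ.≤ s → N ℕ.≤ s) →
    recip s ≤ ½ + bonus (orphan-bonus ∷ star (recip N)) s
  star-dominates N 1≤N 0                   _    = ≤-by-computation
  star-dominates N 1≤N 1                   _    = ≤-by-computation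
  star-dominates N 1≤N 2                   _    = ≤-by-computation
  star-dominates N 1≤N (suc (suc (suc m))) N≤s = ≤-trans (recip-antimono 1≤N (N≤s (s≤s (s≤s (s≤s z≤n)))))
    (≤-reflexive (solve 1 (λ r → r := con ½ :+ (con 0ℚ :+ ((r :- con ½) :+ con 0ℚ))) refl (recip N)))
    where open +-*-Solver

  half-plus-37/39≤ : ∀ n → 13 ℕ.≤ n →
    + n / 2 + + 37 / 39 ≤ ((+ n / 2 + + 1 / 1) + recip (n ℕ.* n ℕ.∸ 5 ℕ.* n)) - (+ 2 / 1) * recip (3 ℕ.* n)
  half-plus-37/39≤ n 13≤n = begin
    + n / 2 + + 37 / 39
      ≡⟨ solve 1 (λ h → h :+ con (+ 37 / 39) := (h :+ con (+ 1 / 1)) :+ con 0ℚ :- con (+ 2 / 1) :* con (+ 1 / 39))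
               refl (+ n / 2) ⟩
    ((+ n / 2 + + 1 / 1) + 0ℚ) - (+ 2 / 1) * (+ 1 / 39)
      ≤⟨ +-mono-≤ (+-monoʳ-≤ (+ n / 2 + + 1 / 1) (recip-nonneg (n ℕ.* n ℕ.∸ 5 ℕ.* n)))
                  (neg-antimono-≤ (*-monoˡ-≤-nonNeg (+ 2 / 1) (recip-antimono (s≤s z≤n) (ℕₚ.*-monoʳ-≤ 3 13≤n)))) ⟩
    ((+ n / 2 + + 1 / 1) + recip (n ℕ.* n ℕ.∸ 5 ℕ.* n)) - (+ 2 / 1) * recip (3 ℕ.* n) ∎
    where
    open ≤-Reasoning
    open +-*-Solver

open Rationals

module ShareBound {n} (C : Code n) (c : Word n) (c∈C : C c ≡ true) (ld : LocDom C) where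

  open Neighbourhood C c c∈C ld
  open import Data.Nat as ℕ using (ℕ; zero; suc; z≤n; s≤s)
  import Data.Nat.Properties as ℕₚ
  open import Data.Integer using (+_)
  open import Data.Rational using (ℚ; _/_; _+_; _-_; _*_; _≤_; 0ℚ; ½; -_)
  open import Data.Rational.Properties
    using (≤-trans; ≤-reflexive; +-mono-≤; +-monoʳ-≤; +-monoˡ-≤; +-identityʳ; module ≤-Reasoning)
  open import Data.Rational.Solver using (module +-*-Solver)
  open import Relation.Nullary.Decidable using (_×-dec_)

  share≡ : share C c ≡ recip (suc k) + ∑ℚ (λ i → recip (t i))
  share≡ = cong₂ _+_ (cong recip cardI-c)
    (trans (cong (sumℚ ∘ List.map (recip ∘ cardI C)) (Listₚ.map-tabulate (λ i → i) (λ i → flipAt i c)))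
           (sumℚ-tabulate (recip ∘ cardI C) x))

  share-≤ : (B : Bonus) → (∀ i → recip (t i) ≤ ½ + bonus (orphan-bonus ∷ B) (t i)) →
    ∀ {δ} → recip (suc k) + (orphans · ½ + total B t) ≤ δ → share C c ≤ + n / 2 + δ
  share-≤ B dominates {δ} r+T≤δ = begin
    share C c
      ≡⟨ share≡ ⟩
    r + ∑ℚ (λ i → recip (t i))
      ≤⟨ +-monoʳ-≤ r (∑ℚ-mono-≤ dominates) ⟩
    r + ∑ℚ (λ i → ½ + bonus B′ (t i))
      ≡⟨ cong (λ q → r + q) (∑ℚ-distrib-+ {n} (λ _ → ½) (λ i → bonus B′ (t i))) ⟩
    r + (∑ℚ {n} (λ _ → ½) + ∑ℚ (λ i → bonus B′ (t i)))
      ≡⟨ cong₂ (λ h T → r + (h + T)) (trans (∑ℚ-replicate n) (·½ n)) (∑-bonus B′ t) ⟩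
    r + (+ n / 2 + total B′ t)
      ≡⟨ solve 3 (λ r h T → r :+ (h :+ T) := h :+ (r :+ T)) refl r (+ n / 2) (total B′ t) ⟩
    + n / 2 + (r + total B′ t)
      ≤⟨ +-monoʳ-≤ (+ n / 2) r+T≤δ ⟩
    + n / 2 + δ ∎
    where
    open ≤-Reasoning
    open +-*-Solver
    r : ℚ
    r = recip (suc k)
    B′ : Bonus
    B′ = orphan-bonus ∷ B

  weaken : ∀ {δ δ′} → share C c ≤ + n / 2 + δ → δ ≤ δ′ → share C c ≤ + n / 2 + δ′
  weaken s≤ δ≤δ′ = ≤-trans s≤ (+-monoʳ-≤ (+ n / 2) δ≤δ′)

  coarse-share : ∀ {r o u} → recip (suc k) ≤ r → orphans ℕ.≤ o → u ℕ.≤ count≥ 3 →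
    share C c ≤ + n / 2 + (r + (o · ½ + (u · - (+ 1 / 6) + 0ℚ)))
  coarse-share r₀≤r orphans≤o u≤fathers = share-≤ coarse (coarse-dominates ∘ t)
    (+-mono-≤ r₀≤r (+-mono-≤ (·-monoˡ-≤ ½ ≤-by-computation orphans≤o)
                             (+-monoˡ-≤ 0ℚ (·-antimonoˡ-≤ (- (+ 1 / 6)) ≤-by-computation (count≥ 3) u≤fathers))))

  recip-suc-k≤ : ∀ {a} → k ≡ a → recip (suc k) ≤ recip (suc a)
  recip-suc-k≤ k≡a = ≤-reflexive (cong (recip ∘ suc) k≡a)

  share-k≥2 : 2 ℕ.≤ k → share C c ≤ + n / 2 + + 5 / 6
  share-k≥2 2≤k = weaken (coarse-share (recip-antimono (s≤s z≤n) (s≤s 2≤k)) orphans≤1 z≤n) ≤-by-computation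

  share-k≡1 : 3 ℕ.≤ n → k ≡ 1 → share C c ≤ + n / 2 + + 5 / 6
  share-k≡1 3≤n k≡1 =
    weaken (coarse-share (recip-suc-k≤ k≡1) orphans≤1 (father-exists 3≤n (ℕₚ.≤-reflexive k≡1))) ≤-by-computation

  share-orphanless : 3 ℕ.≤ n → k ≡ 0 → orphans ≡ 0 → share C c ≤ + n / 2 + + 5 / 6
  share-orphanless 3≤n k≡0 o≡0 =
    weaken (coarse-share (recip-suc-k≤ k≡0) (ℕₚ.≤-reflexive o≡0) (father-exists 3≤n (k≡0⇒k≤1 k≡0)))
      ≤-by-computation

  Bounds : Set
  Bounds = share C c ≤ + n / 2 + + 1 / 1 × (13 ℕ.≤ n → share C c ≤ + n / 2 + + 37 / 39)

  bounds-5/6 : share C c ≤ + n / 2 + + 5 / 6 → Bounds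
  bounds-5/6 s≤ = weaken s≤ ≤-by-computation , λ _ → weaken s≤ ≤-by-computation

  module IsolatedShare (k≡0 : k ≡ 0) (o≡1 : orphans ≡ 1) where

    open Isolated k≡0 o≡1

    isolated-share : ∀ B → (∀ i → recip (t i) ≤ ½ + bonus (orphan-bonus ∷ B) (t i)) →
      ∀ {R} → total B t ≤ R → share C c ≤ + n / 2 + (recip 1 + (1 · ½ + R))
    isolated-share B dominates T≤R =
      share-≤ B dominates (+-mono-≤ (recip-suc-k≤ k≡0) (+-mono-≤ (≤-reflexive (cong (_· ½) o≡1)) T≤R))

    share-fine₄₆ : ∀ {u a} → count≥ 3 ≡ u → a ℕ.≤ count≥ 4 ℕ.+ count≥ 6 →
      share C c ≤ + n / 2 + (recip 1 + (1 · ½ + (u · - (+ 1 / 6) + (a · - (+ 1 / 12) + 0ℚ))))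
    share-fine₄₆ u≡ a≤ = isolated-share fine₄₆ (fine₄₆-dominates ∘ t)
      (+-mono-≤ (≤-reflexive (cong (_· - (+ 1 / 6)) u≡))
                (·-+-antimono (- (+ 1 / 12)) ≤-by-computation (count≥ 4) (count≥ 6) 0ℚ a≤))

    share-fine₉ : ∀ {u} → count≥ 3 ≡ u → 1 ℕ.≤ count≥ 9 →
      share C c ≤ + n / 2 + (recip 1 + (1 · ½ + (u · - (+ 1 / 6) + (1 · - (+ 2 / 9) + 0ℚ))))
    share-fine₉ u≡ 1≤c₉ = isolated-share fine₉ (fine₉-dominates ∘ t)
      (+-mono-≤ (≤-reflexive (cong (_· - (+ 1 / 6)) u≡))
                (+-monoˡ-≤ 0ℚ (·-antimonoˡ-≤ (- (+ 2 / 9)) ≤-by-computation (count≥ 9) 1≤c₉)))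

    share-star : 2 ℕ.≤ n → count≥ 3 ≡ 1 → share C c ≤ (+ n / 2 + + 1 / 1) + recip (n ℕ.∸ 1)
    share-star 2≤n u≡1 = ≤-trans
      (isolated-share (star r)
        (λ i → star-dominates (n ℕ.∸ 1) (ℕₚ.∸-monoˡ-≤ 1 2≤n) (t i) (large-father u≡1))
        (≤-reflexive (cong (λ u → u · (r - ½) + 0ℚ) u≡1)))
      (≤-reflexive (solve 2 (λ h r → h :+ (con (+ 1 / 1) :+ ((con ½ :+ con 0ℚ) :+
                                                             (((r :- con ½) :+ con 0ℚ) :+ con 0ℚ)))
                                       := (h :+ con (+ 1 / 1)) :+ r)
                            refl (+ n / 2) r))
      where
      open +-*-Solver
      r : ℚ
      r = recip (n ℕ.∸ 1)

    isolated-bounds : 10 ℕ.≤ n → count≥ 3 ≢ 1 → Bounds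
    isolated-bounds 10≤n u≢1 with count≥ 3 in u≡
    ... | 0 = contradiction (ℕₚ.≤-trans (father-exists 3≤n (k≡0⇒k≤1 k≡0)) (ℕₚ.≤-reflexive u≡)) λ ()
      where
      3≤n : 3 ℕ.≤ n
      3≤n = ℕₚ.≤-trans (s≤s (s≤s (s≤s z≤n))) 10≤n
    ... | 1 = contradiction refl u≢1
    ... | 2 = weaken (share-fine₄₆ u≡ (two-fathers u≡ 10≤n)) ≤-by-computation ,
              λ 13≤n → [ (λ 3≤c₄+c₆ → weaken (share-fine₄₆ u≡ 3≤c₄+c₆) ≤-by-computation)
                       , (λ 1≤c₉ → weaken (share-fine₉ u≡ 1≤c₉) ≤-by-computation)
                       ]′ (two-fathers-13 u≡ 13≤n)
    ... | 3 = weaken (coarse-share (recip-suc-k≤ k≡0) orphans≤1 (ℕₚ.≤-reflexive (sym u≡))) ≤-by-computation ,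
              λ 13≤n → weaken (share-fine₄₆ u≡ (ℕₚ.≤-trans (three-fathers u≡ 13≤n) (ℕₚ.m≤m+n _ _)))
                              ≤-by-computation
    ... | suc (suc (suc (suc _))) = bounds-5/6 (weaken
            (coarse-share (recip-suc-k≤ k≡0) orphans≤1 (ℕₚ.≤-trans 4≤4+ (ℕₚ.≤-reflexive (sym u≡))))
            ≤-by-computation)
      where
      4≤4+ : ∀ {m} → 4 ℕ.≤ 4 ℕ.+ m
      4≤4+ = s≤s (s≤s (s≤s (s≤s z≤n)))

  Star : Set
  Star = k ≡ 0 × orphans ≡ 1 × count≥ 3 ≡ 1

  module _ (10≤n : 10 ℕ.≤ n) where

    3≤n : 3 ℕ.≤ n
    3≤n = ℕₚ.≤-trans (s≤s (s≤s (s≤s z≤n))) 10≤n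

    -- The with-abstraction also rewrites k and orphans inside the type of ¬⋆, hence the refl's below.
    unstarred-bounds : ¬ Star → Bounds
    unstarred-bounds ¬⋆ with k in k≡ | orphans in o≡
    ... | suc (suc _) | _           = bounds-5/6 (share-k≥2 (ℕₚ.≤-trans 2≤2+ (ℕₚ.≤-reflexive (sym k≡))))
      where
      2≤2+ : ∀ {m} → 2 ℕ.≤ 2 ℕ.+ m
      2≤2+ = s≤s (s≤s z≤n)
    ... | 1           | _           = bounds-5/6 (share-k≡1 3≤n k≡)
    ... | 0           | 0           = bounds-5/6 (share-orphanless 3≤n k≡ o≡)
    ... | 0           | 1           = IsolatedShare.isolated-bounds k≡ o≡ 10≤n λ u≡1 → ¬⋆ (refl , refl , u≡1)
    ... | 0           | suc (suc _) =
      contradiction (ℕₚ.≤-trans (ℕₚ.≤-reflexive (sym o≡)) orphans≤1) λ { (s≤s ()) }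

    share-bound : share C c ≤ (+ n / 2 + + 1 / 1) + recip (n ℕ.∸ 1)
    share-bound with (k ℕ.≟ 0) ×-dec (orphans ℕ.≟ 1) ×-dec (count≥ 3 ℕ.≟ 1)
    ... | yes (k≡0 , o≡1 , u≡1) = IsolatedShare.share-star k≡0 o≡1 (ℕₚ.≤-trans (s≤s (s≤s z≤n)) 3≤n) u≡1
    ... | no  ¬⋆                = ≤-trans (proj₁ (unstarred-bounds ¬⋆)) (begin
      + n / 2 + + 1 / 1                           ≡⟨ sym (+-identityʳ _) ⟩
      (+ n / 2 + + 1 / 1) + 0ℚ                    ≤⟨ +-monoʳ-≤ (+ n / 2 + + 1 / 1) (recip-nonneg (n ℕ.∸ 1)) ⟩
      (+ n / 2 + + 1 / 1) + recip (n ℕ.∸ 1)       ∎)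
      where open ≤-Reasoning

    nonspecial-bounds : ¬ Special C c → Bounds
    nonspecial-bounds ¬special = unstarred-bounds λ (k≡0 , o≡1 , u≡1) → ¬special (special k≡0 o≡1 u≡1)

open import Data.Nat as ℕ using (ℕ)
open import Data.Integer using (+_)
open import Data.Rational using (ℚ; _/_; _+_; _-_; _*_; _≤_)
open import Data.Rational.Properties using (≤-trans)

lemma4 : (n : ℕ) → 10 ℕ.≤ n → (C : Code n) → Nonempty C → LocDom C →
    ((c : Word n) → C c ≡ true →
      share C c ≤ ((+ n / 2) + (+ 1 / 1)) + recip (n ℕ.∸ 1)) ×
    ((c : Word n) → C c ≡ true → ¬ Special C c →
      share C c ≤ (+ n / 2) + (+ 1 / 1)) ×
    (13 ℕ.≤ n → (c : Word n) → C c ≡ true → ¬ Special C c →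
      share C c ≤ (((+ n / 2) + (+ 1 / 1)) + recip (n ℕ.* n ℕ.∸ 5 ℕ.* n))
                    - ((+ 2 / 1) * recip (3 ℕ.* n)))
lemma4 n 10≤n C _ ld =
  (λ c c∈C → share-bound C c c∈C ld 10≤n) ,
  (λ c c∈C ¬special → proj₁ (nonspecial-bounds C c c∈C ld 10≤n ¬special)) ,
  (λ 13≤n c c∈C ¬special →
     ≤-trans (proj₂ (nonspecial-bounds C c c∈C ld 10≤n ¬special) 13≤n) (half-plus-37/39≤ n 13≤n))
  where open ShareBound using (share-bound; nonspecial-bounds)
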